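{- Let $G=(V,E)$ be a finite graph with at least one vertex and $k>0$ an integer. Then $G$ has an $S_k$-tree over $\mathcal F_k$ if and only if $\mathrm{tw}(G)<k-1$. More precisely, for a finite tree $T$, there is a map $\alpha$ such that $(T,\alpha)$ is an $S_k$-tree over $\mathcal F_k$ if and only if $G$ admits a tree-decomposition $(T,\mathcal V)$ (with this decomposition tree $T$) of width $<k-1$.
   Context: An (oriented vertex) separation of $G$ is a pair $(A,B)$ of (possibly empty) subsets of $V$ with $A\cup B=V$ and no edge between $A\setminus B$ and $B\setminus A$; $\vec U$ is the set of these, ordered by $(A,B)\le(C,D)$ iff $A\subseteq C$ and $B\supseteq D$, with inverse $(B,A)$. Order of $(A,B)$: $|A\cap B|$; $\vec S_k$ is the set of separations of order $<k$. A star is a set $\sigma$ of separations with $(A,B)\ne(B,A)$ for each element and $(A,B)\le(D,C)$ for all distinct $(A,B),(C,D)\in\sigma$. $\mathcal F_k$ is the set of stars $\{(A_i,B_i):i=0,\dots,n\}\subseteq\vec U$ with $|\bigcap_{i=0}^nB_i|<k$ (intersection $=V$ for the empty star). An $S_k$-tree over $\mathcal F_k$ is a pair $(T,\alpha)$, $T$ a finite tree with at least one node, $\alpha$ assigning to each ordered pair $(x,y)$ with $xy\in E(T)$ an element $\alpha(x,y)\in\vec S_k$ such that $\alpha(y,x)$ is the inverse of $\alpha(x,y)$ and $\{\alpha(x,t):xt\in E(T)\}\in\mathcal F_k$ for every node $t$. Tree-decompositions, their width ($\max_t|V_t|-1$) and tree-width $\mathrm{tw}(G)$ are the standard notions. 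-}

module Defs where

open import Data.Nat using (ℕ; _<_; _≤_; _∸_; _⊔_)
open import Data.Bool using (Bool; true; false)
open import Data.Fin using (Fin)
open import Data.Fin.Subset using (Subset; _∈_; _∉_; _⊆_; _∩_; ⋂; ∣_∣)
open import Data.List using (List; []; _∷_; map; foldr; allFin; filterᵇ; length)
import Data.List.Membership.Propositional as LM
open import Data.List.Relation.Unary.Unique.Propositional using (Unique)
open import Data.Product using (_×_; _,_; proj₁; proj₂; ∃; ∃-syntax; Σ-syntax)
open import Data.Sum using (_⊎_)
open import Data.Empty using (⊥)
open import Relation.Binary.PropositionalEquality using (_≡_; _≢_)

record Graph : Set where
  field
    n      : ℕ
    adj    : Fin n → Fin n → Bool
    adj-sym    : ∀ u v → adj u v ≡ adj v u
    adj-irrefl : ∀ v → adj v v ≡ false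

module _ (G : Graph) where
  open Graph G

  Vertex : Set
  Vertex = Fin n

  Edge : Vertex → Vertex → Set
  Edge u v = adj u v ≡ true

  data Walk : Vertex → Vertex → Set where
    stop : ∀ x → Walk x x
    step : ∀ {x y z} → Edge x y → Walk y z → Walk x z

  verts : ∀ {x y} → Walk x y → List Vertex
  verts (stop x) = x ∷ []
  verts (step {x} _ w) = x ∷ verts w

  IsPath : ∀ {x y} → Walk x y → Set
  IsPath w = Unique (verts w)

  Connected : Set
  Connected = ∀ x y → Walk x y

  Acyclic : Set
  Acyclic = ∀ x y (w : Walk x y) → IsPath w → 3 ≤ length (verts w) → Edge y x → ⊥

record Tree : Set where
  field
    graph     : Graph
    nonempty  : 1 ≤ Graph.n graph
    connected : Connected graph
    acyclic   : Acyclic graph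

  Node : Set
  Node = Vertex graph

  TEdge : Node → Node → Set
  TEdge = Edge graph

record TreeDecomposition (G : Graph) (T : Tree) : Set where
  open Tree T
  field
    bag : Node → Subset (Graph.n G)
    cover      : ∀ v → ∃[ t ] (v ∈ bag t)
    edge-cover : ∀ u v → Edge G u v → ∃[ t ] (u ∈ bag t × v ∈ bag t)
    path-cond  : ∀ t₁ t₃ (w : Walk graph t₁ t₃) → IsPath graph w →
                 ∀ t₂ → t₂ LM.∈ verts graph w → (bag t₁ ∩ bag t₃) ⊆ bag t₂

width : ∀ {G T} → TreeDecomposition G T → ℕ
width {G} {T} D =
  foldr _⊔_ 0 (map (λ t → ∣ TreeDecomposition.bag D t ∣) (allFin (Graph.n (Tree.graph T)))) ∸ 1

TwBelow : Graph → ℕ → Set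
TwBelow G w = ∃[ T ] ∃[ D ] (width {G} {T} D < w)

Sep : ℕ → Set
Sep n = Subset n × Subset n

IsSep : (G : Graph) → Sep (Graph.n G) → Set
IsSep G (A , B) =
  (∀ v → v ∈ A ⊎ v ∈ B) ×
  (∀ u v → u ∈ A → u ∉ B → v ∈ B → v ∉ A → Edge G u v → ⊥)

inv : ∀ {n} → Sep n → Sep n
inv (A , B) = (B , A)

_≤ₛ_ : ∀ {n} → Sep n → Sep n → Set
(A , B) ≤ₛ (C , D) = (A ⊆ C) × (D ⊆ B)

order : ∀ {n} → Sep n → ℕ
order (A , B) = ∣ A ∩ B ∣

InSk : (G : Graph) → ℕ → Sep (Graph.n G) → Set
InSk G k s = IsSep G s × order s < k

IsStar : ∀ {n} → List (Sep n) → Set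
IsStar σ = (∀ s → s LM.∈ σ → s ≢ inv s) ×
           (∀ s t → s LM.∈ σ → t LM.∈ σ → s ≢ t → s ≤ₛ inv t)

InFk : (G : Graph) → ℕ → List (Sep (Graph.n G)) → Set
InFk G k σ = (∀ s → s LM.∈ σ → IsSep G s) × IsStar σ × (∣ ⋂ (map proj₂ σ) ∣ < k)

-- S_k-trees over F_k. α is a function on all ordered pairs of nodes;
-- only its values on (ordered) edges of T matter.

module _ (G : Graph) (k : ℕ) (T : Tree) where
  open Tree T

  starAt : (Node → Node → Sep (Graph.n G)) → Node → List (Sep (Graph.n G))
  starAt α t = map (λ x → α x t) (filterᵇ (λ x → Graph.adj graph x t) (allFin (Graph.n graph)))

  IsSkTree : (Node → Node → Sep (Graph.n G)) → Set
  IsSkTree α =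
    (∀ x y → TEdge x y → InSk G k (α x y) × α y x ≡ inv (α x y)) ×
    (∀ t → InFk G k (starAt α t))

-- An S_k-tree (T , α) yields a tree-decomposition over T whose bag at t is the intersection of
-- the B-sides of the separations (A , B) pointing at t, which has fewer than k vertices by the
-- F_k condition; each edge of G lies on one side of every separation, and following the
-- separations not containing it on their B-side leads to a node whose bag contains it.  The path
-- condition needs consistency, α(x , y) ≤ α(y , z) along every path x y z; the star condition
-- only gives this when α(x , y) ≠ α(z , y), so offending pairs are first removed by reorienting a
-- whole branch trivially towards its root.  Conversely, a tree-decomposition of width < k - 1
-- orients each edge xy by (union of the bags on x's side , union of the bags on y's side), a
-- separation whose order is at most |V_x| by the path condition and whose stars have the bags as
-- their intersections.  That separation is proper unless it is (V , V), which only matters when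
-- |V| < k; then orienting all edges trivially towards a root works.

module Submission where

open import Defs
open import Data.Nat using (ℕ; zero; suc; _<_; _≤_; _∸_; _⊔_; z≤n; s≤s; _<?_)
open import Data.Nat.Properties
  using (≤-refl; ≤-trans; ≤-reflexive; <⇒≱; m≤m⊔n; m≤n⊔m; ⊔-lub; ≮⇒≥; ≤-pred; <-≤-trans; ≤-<-trans; m≤n⇒m≤1+n; ∸-monoˡ-<)
open import Data.Bool using (Bool; true; false; _∨_; if_then_else_)
open import Data.Bool.Properties using (T-≡) renaming (_≟_ to _≟B_)
open import Data.Fin using (Fin; fromℕ<) renaming (_≟_ to _≟F_)
open import Data.Fin.Properties using (any?)
open import Data.Fin.Subset using (Subset; _∈_; _∉_; _⊆_; _∩_; ⋂; ⋃; ∣_∣) renaming (⊤ to Full; ⊥ to ∅)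
open import Data.Fin.Subset.Properties
  using (x∈p∩q⁺; x∈p∩q⁻; x∈p∪q⁺; x∈p∪q⁻; ∈⊤; ∉⊥; ⊥⊆; ⊆⊤; p⊆q⇒∣p∣≤∣q∣; ∣⊥∣≡0; ∣⁅x⁆∣≡1; x∈⁅y⁆⇒x≡y; ∣⊤∣≡n; ∣p∩q∣≤∣p∣; ∣p∩q∣≤∣q∣)
  renaming (_∈?_ to _∈ˢ?_; _⊆?_ to _⊆ˢ?_)
open import Data.List using (List; []; _∷_; length; map; filter; filterᵇ; allFin; foldr; cartesianProduct)
open import Data.List.Relation.Unary.Any using (here; there)
import Data.List.Relation.Unary.All as All
open import Data.List.Relation.Unary.All using ([])
open import Data.List.Properties using (map-cong-local; foldr-preservesᵇ; foldr-preservesᵒ)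
import Data.List.Relation.Unary.Any as Any
import Data.List.Relation.Unary.All.Properties as All
open import Data.List.Relation.Unary.All.Properties using (¬Any⇒All¬; All¬⇒¬Any)
open import Data.List.Relation.Unary.AllPairs using ([]; _∷_)
open import Data.List.Membership.Propositional using () renaming (_∈_ to _∈ᴸ_; _∉_ to _∉ᴸ_)
open import Data.List.Membership.Propositional.Properties
  using (∈-map⁺; ∈-map⁻; ∈-filter⁺; ∈-filter⁻; ∈-allFin; ∈-cartesianProduct⁺)
import Data.List.Membership.DecPropositional as DecMembership
import Data.Product
open import Data.Product using (_×_; _,_; proj₁; proj₂; Σ; ∃-syntax)
open import Data.Product.Properties using (≡-dec)
import Data.Sum as Sum
open import Data.Sum using (_⊎_; inj₁; inj₂; [_,_])
open import Data.Empty using (⊥)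
open import Data.Vec.Properties using () renaming (≡-dec to ≡-decᵛ)
open import Function using (_∘_; id; const; flip)
open import Function.Bundles using (_⇔_; mk⇔; Equivalence)
open import Relation.Nullary using (¬_; Dec; yes; no; ¬?; _×-dec_; contradiction)
open import Relation.Nullary.Decidable using (T?)
open import Relation.Unary using (Decidable)
open import Relation.Binary.Definitions using (DecidableEquality)
open import Relation.Binary.PropositionalEquality using (_≡_; _≢_; refl; sym; trans; cong; subst; subst₂)

module _ {a p} {A : Set a} {P Q : A → Set p} (P? : Decidable P) (Q? : Decidable Q)
         (P⇒Q : ∀ {x} → P x → Q x) where

  length-filter-mono : ∀ xs → length (filter P? xs) ≤ length (filter Q? xs)
  length-filter-mono [] = z≤n
  length-filter-mono (x ∷ xs) with P? x | Q? x
  ... | yes _ | yes _ = s≤s (length-filter-mono xs)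
  ... | yes p | no ¬q = contradiction (P⇒Q p) ¬q
  ... | no _  | yes _ = m≤n⇒m≤1+n (length-filter-mono xs)
  ... | no _  | no _  = length-filter-mono xs

  length-filter-< : ∀ {x xs} → x ∈ᴸ xs → Q x → ¬ P x →
                    length (filter P? xs) < length (filter Q? xs)
  length-filter-< {xs = y ∷ xs} (here refl) q ¬p with P? y | Q? y
  ... | yes p | _     = contradiction p ¬p
  ... | no _  | yes _ = s≤s (length-filter-mono xs)
  ... | no _  | no ¬q = contradiction q ¬q
  length-filter-< {xs = y ∷ xs} (there x∈xs) q ¬p with P? y | Q? y
  ... | yes _ | yes _ = s≤s (length-filter-< x∈xs q ¬p)
  ... | yes p | no ¬q = contradiction (P⇒Q p) ¬q
  ... | no _  | yes _ = m≤n⇒m≤1+n (length-filter-< x∈xs q ¬p)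
  ... | no _  | no _  = length-filter-< x∈xs q ¬p

Bool-cases : ∀ b → b ≡ true ⊎ b ≡ false
Bool-cases true = inj₁ refl
Bool-cases false = inj₂ refl

∨-cases : ∀ b₁ b₂ → (b₁ ≡ true ⊎ b₂ ≡ true) ⊎ (b₁ ≡ false × b₂ ≡ false)
∨-cases true _ = inj₁ (inj₁ refl)
∨-cases false true = inj₁ (inj₂ refl)
∨-cases false false = inj₂ (refl , refl)

module _ {a} {A : Set a} {u v : A} where

  if-∨-true : ∀ b₁ b₂ → b₁ ≡ true ⊎ b₂ ≡ true → (if b₁ ∨ b₂ then u else v) ≡ u
  if-∨-true true _ _ = refl
  if-∨-true false true _ = refl
  if-∨-true false false (inj₁ ())
  if-∨-true false false (inj₂ ())

  if-∨-false : ∀ {b₁ b₂} → b₁ ≡ false → b₂ ≡ false → (if b₁ ∨ b₂ then u else v) ≡ v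
  if-∨-false refl refl = refl

module _ {m : ℕ} where

  ∈-⋂⁻ : ∀ {ps : List (Subset m)} {v} → v ∈ ⋂ ps → ∀ {q} → q ∈ᴸ ps → v ∈ q
  ∈-⋂⁻ {p ∷ ps} v∈ (here refl) = proj₁ (x∈p∩q⁻ p (⋂ ps) v∈)
  ∈-⋂⁻ {p ∷ ps} v∈ (there q∈) = ∈-⋂⁻ (proj₂ (x∈p∩q⁻ p (⋂ ps) v∈)) q∈

  ∈-⋂⁺ : ∀ {ps : List (Subset m)} {v} → (∀ {q} → q ∈ᴸ ps → v ∈ q) → v ∈ ⋂ ps
  ∈-⋂⁺ {[]} _ = ∈⊤
  ∈-⋂⁺ {p ∷ ps} h = x∈p∩q⁺ (h (here refl) , ∈-⋂⁺ (h ∘ there))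

  ∈-⋃⁻ : ∀ {ps : List (Subset m)} {v} → v ∈ ⋃ ps → ∃[ q ] (q ∈ᴸ ps × v ∈ q)
  ∈-⋃⁻ {[]} v∈ = contradiction v∈ ∉⊥
  ∈-⋃⁻ {p ∷ ps} v∈ with x∈p∪q⁻ p (⋃ ps) v∈
  ... | inj₁ v∈p = p , here refl , v∈p
  ... | inj₂ v∈⋃ps with ∈-⋃⁻ {ps} v∈⋃ps
  ...   | q , q∈ , v∈q = q , there q∈ , v∈q

  ∈-⋃⁺ : ∀ {ps : List (Subset m)} {v q} → q ∈ᴸ ps → v ∈ q → v ∈ ⋃ ps
  ∈-⋃⁺ {p ∷ ps} (here refl) v∈q = x∈p∪q⁺ (inj₁ v∈q)
  ∈-⋃⁺ {p ∷ ps} (there q∈) v∈q = x∈p∪q⁺ (inj₂ (∈-⋃⁺ q∈ v∈q))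

  x∈p⇒0<∣p∣ : ∀ {p : Subset m} {x} → x ∈ p → 0 < ∣ p ∣
  x∈p⇒0<∣p∣ {p} {x} x∈p = ≤-trans (≤-reflexive (sym (∣⁅x⁆∣≡1 x)))
                                  (p⊆q⇒∣p∣≤∣q∣ (λ y∈ → subst (_∈ p) (sym (x∈⁅y⁆⇒x≡y x y∈)) x∈p))

module Walks (G : Graph) where
  open Graph G
  open DecMembership (_≟F_ {n}) using (_∈?_)

  Edge-sym : ∀ {u v} → Edge G u v → Edge G v u
  Edge-sym {u} {v} e = trans (adj-sym v u) e

  Edge-irrefl : ∀ {u v} → Edge G u v → u ≢ v
  Edge-irrefl {u} e refl with () ← trans (sym e) (adj-irrefl u)

  source∈verts : ∀ {a b} (w : Walk G a b) → a ∈ᴸ verts G w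
  source∈verts (stop _) = here refl
  source∈verts (step _ _) = here refl

  target∈verts : ∀ {a b} (w : Walk G a b) → b ∈ᴸ verts G w
  target∈verts (stop _) = here refl
  target∈verts (step _ w) = there (target∈verts w)

  _++ʷ_ : ∀ {a b c} → Walk G a b → Walk G b c → Walk G a c
  stop _ ++ʷ w = w
  step e w ++ʷ w' = step e (w ++ʷ w')

  ∈-++ʷ⁻ : ∀ {a b c} (w₁ : Walk G a b) (w₂ : Walk G b c) {v} →
           v ∈ᴸ verts G (w₁ ++ʷ w₂) → v ∈ᴸ verts G w₁ ⊎ v ∈ᴸ verts G w₂
  ∈-++ʷ⁻ (stop _) w₂ v∈ = inj₂ v∈
  ∈-++ʷ⁻ (step e w₁) w₂ (here refl) = inj₁ (here refl)
  ∈-++ʷ⁻ (step e w₁) w₂ (there v∈) = Sum.map₁ there (∈-++ʷ⁻ w₁ w₂ v∈)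

  ∉-++ʷ : ∀ {a b c x} (w₁ : Walk G a b) (w₂ : Walk G b c) →
          x ∉ᴸ verts G w₁ → x ∉ᴸ verts G w₂ → x ∉ᴸ verts G (w₁ ++ʷ w₂)
  ∉-++ʷ w₁ w₂ x∉₁ x∉₂ x∈ = [ x∉₁ , x∉₂ ] (∈-++ʷ⁻ w₁ w₂ x∈)

  reverse : ∀ {a b} → Walk G a b → Walk G b a
  reverse (stop a) = stop a
  reverse (step e w) = reverse w ++ʷ step (Edge-sym e) (stop _)

  ∈-reverse⁻ : ∀ {a b} (w : Walk G a b) {v} → v ∈ᴸ verts G (reverse w) → v ∈ᴸ verts G w
  ∈-reverse⁻ (stop _) v∈ = v∈
  ∈-reverse⁻ (step e w) v∈ with ∈-++ʷ⁻ (reverse w) (step (Edge-sym e) (stop _)) v∈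
  ... | inj₁ v∈w = there (∈-reverse⁻ w v∈w)
  ... | inj₂ (here refl) = there (source∈verts w)
  ... | inj₂ (there (here refl)) = here refl

  ∉-reverse : ∀ {a b x} (w : Walk G a b) → x ∉ᴸ verts G w → x ∉ᴸ verts G (reverse w)
  ∉-reverse w x∉ = x∉ ∘ ∈-reverse⁻ w

  edges : ∀ {a b} → Walk G a b → List (Vertex G × Vertex G)
  edges (stop _) = []
  edges (step {x} {y} _ w) = (x , y) ∷ edges w

  ∈-edges⇒∈verts : ∀ {a b u v} (w : Walk G a b) → (u , v) ∈ᴸ edges w → v ∈ᴸ verts G w
  ∈-edges⇒∈verts (step e w) (here refl) = there (source∈verts w)
  ∈-edges⇒∈verts (step e w) (there uv∈) = there (∈-edges⇒∈verts w uv∈)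

  ∈-edges-++ʷ⁻ : ∀ {a b c} (w₁ : Walk G a b) (w₂ : Walk G b c) {e} →
                 e ∈ᴸ edges (w₁ ++ʷ w₂) → e ∈ᴸ edges w₁ ⊎ e ∈ᴸ edges w₂
  ∈-edges-++ʷ⁻ (stop _) w₂ e∈ = inj₂ e∈
  ∈-edges-++ʷ⁻ (step e w₁) w₂ (here refl) = inj₁ (here refl)
  ∈-edges-++ʷ⁻ (step e w₁) w₂ (there e∈) = Sum.map₁ there (∈-edges-++ʷ⁻ w₁ w₂ e∈)

  ∈-edges-reverse⁻ : ∀ {a b} (w : Walk G a b) {u v} →
                     (u , v) ∈ᴸ edges (reverse w) → (v , u) ∈ᴸ edges w
  ∈-edges-reverse⁻ (step e w) uv∈ with ∈-edges-++ʷ⁻ (reverse w) (step (Edge-sym e) (stop _)) uv∈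
  ... | inj₁ uv∈w = there (∈-edges-reverse⁻ w uv∈w)
  ... | inj₂ (here refl) = here refl

  prefix : ∀ {a b t} (w : Walk G a b) → t ∈ᴸ verts G w →
           Σ (Walk G a t) λ p → ∀ {v} → v ∈ᴸ verts G p → v ∈ᴸ verts G w
  prefix (stop _) (here refl) = stop _ , id
  prefix (step e w) (here refl) = stop _ , λ { (here refl) → here refl }
  prefix (step e w) (there t∈) with prefix w t∈
  ... | p , p⊆w = step e p , λ { (here refl) → here refl ; (there v∈) → there (p⊆w v∈) }

  PathAlong : ∀ {a b} → Walk G a b → Walk G a b → Set
  PathAlong w p = IsPath G p × (∀ {e} → e ∈ᴸ edges p → e ∈ᴸ edges w)

  suffix : ∀ {a b c} (p : Walk G c b) → a ∈ᴸ verts G p →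
           Σ (Walk G a b) λ q → (IsPath G p → IsPath G q) × (∀ {e} → e ∈ᴸ edges q → e ∈ᴸ edges p)
  suffix (stop _) (here refl) = stop _ , id , id
  suffix (step e w) (here refl) = step e w , id , id
  suffix (step e w) (there a∈) with suffix w a∈
  ... | q , path , q⊆w = q , (λ { (_ ∷ U) → path U }) , there ∘ q⊆w

  toPath : ∀ {a b} (w : Walk G a b) → Σ (Walk G a b) (PathAlong w)
  toPath (stop a) = stop a , ([] ∷ []) , λ ()
  toPath (step {a} e w) with toPath w
  ... | p , U , p⊆w with a ∈? verts G p
  ...   | yes a∈p with suffix p a∈p
  ...     | q , path , q⊆p = q , path U , there ∘ p⊆w ∘ q⊆p
  toPath (step {a} e w) | p , U , p⊆w | no a∉p =
    step e p , (¬Any⇒All¬ (verts G p) a∉p ∷ U) ,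
    λ { (here refl) → here refl ; (there e∈) → there (p⊆w e∈) }

  firstStep : ∀ {t s} → t ≢ s → Walk G t s →
              ∃[ x ] (Edge G t x × Σ (Walk G x s) λ w → t ∉ᴸ verts G w)
  firstStep t≢s w with toPath w
  ... | stop _ , _ , _ = contradiction refl t≢s
  ... | step {y = x} e p , (t∉p ∷ _) , _ = x , e , p , All¬⇒¬Any t∉p

-- The two sides of an edge of a tree

module Sides (T : Tree) where
  open Tree T
  open Walks graph public
  open DecMembership (_≟F_ {Graph.n graph}) using (_∈?_)

  Side : Node → Node → Node → Set
  Side x y t = Σ (Walk graph y t) λ w → x ∉ᴸ verts graph w

  Side-here : ∀ {x y} → x ≢ y → Side x y y
  Side-here x≢y = stop _ , λ { (here x≡y) → x≢y x≡y }

  ¬Side-source : ∀ {x y} → ¬ Side x y x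
  ¬Side-source (w , x∉) = x∉ (target∈verts w)

  Side-step : ∀ {x y t} → Edge graph y t → x ≢ y → x ≢ t → Side x y t
  Side-step e x≢y x≢t = step e (stop _) , λ { (here x≡y) → x≢y x≡y ; (there (here x≡t)) → x≢t x≡t }

  Side-extend : ∀ {x y a t} → Side x y a → Edge graph a t → x ≢ t → Side x y t
  Side-extend (w , x∉) e x≢t =
    w ++ʷ step e (stop _) ,
    ∉-++ʷ w (step e (stop _)) x∉ λ { (here refl) → x∉ (target∈verts w) ; (there (here x≡t)) → x≢t x≡t }

  no-cycle : ∀ {a b} (p : Walk graph a b) → IsPath graph p → Edge graph b a →
             (a , b) ∉ᴸ edges p → ⊥
  no-cycle (stop _) _ e _ = Edge-irrefl e refl
  no-cycle (step e (stop _)) _ _ ab∉ = ab∉ (here refl)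
  no-cycle (step e (step e' q)) U e-ba _ =
    acyclic _ _ (step e (step e' q)) U (s≤s (s≤s (1≤length q))) e-ba
    where
    1≤length : ∀ {a b} (q : Walk graph a b) → 1 ≤ length (verts graph q)
    1≤length (stop _) = s≤s z≤n
    1≤length (step _ _) = s≤s z≤n

  -- Going from y to t and back to x along the two walks, only to leave through the edge yx,
  -- would close a cycle.
  Side-exclusive : ∀ {x y t} → Edge graph x y → Side x y t → Side y x t → ⊥
  Side-exclusive {x} {y} e-xy (w-y , x∉) (w-x , y∉) with toPath (w-y ++ʷ reverse w-x)
  ... | p , U , p⊆w = no-cycle p U e-xy (yx∉ ∘ p⊆w)
    where
    yx∉ : (y , x) ∉ᴸ edges (w-y ++ʷ reverse w-x)
    yx∉ yx∈ with ∈-edges-++ʷ⁻ w-y (reverse w-x) yx∈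
    ... | inj₁ yx∈₁ = x∉ (∈-edges⇒∈verts w-y yx∈₁)
    ... | inj₂ yx∈₂ = y∉ (∈-edges⇒∈verts w-x (∈-edges-reverse⁻ w-x yx∈₂))

  -- The last visit of a walk to x or y decides on which side its end lies.
  Side-or-avoiding : ∀ {x y} → x ≢ y → ∀ {a t} (w : Walk graph a t) →
    Side x y t ⊎ Side y x t ⊎ Σ (Walk graph a t) (λ w' → x ∉ᴸ verts graph w' × y ∉ᴸ verts graph w')
  Side-or-avoiding {x} {y} x≢y (stop t) with t ≟F x | t ≟F y
  ... | yes refl | _ = inj₂ (inj₁ (Side-here (x≢y ∘ sym)))
  ... | no _ | yes refl = inj₁ (Side-here x≢y)
  ... | no t≢x | no t≢y = inj₂ (inj₂ (stop t , (λ { (here x≡t) → t≢x (sym x≡t) }) ,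
                                               (λ { (here y≡t) → t≢y (sym y≡t) })))
  Side-or-avoiding {x} {y} x≢y (step {a} e w) with Side-or-avoiding x≢y w
  ... | inj₁ s = inj₁ s
  ... | inj₂ (inj₁ s) = inj₂ (inj₁ s)
  ... | inj₂ (inj₂ (w' , x∉ , y∉)) with a ≟F x | a ≟F y
  ...   | yes refl | _ = inj₂ (inj₁ (step e w' , λ { (here y≡x) → x≢y (sym y≡x) ; (there y∈) → y∉ y∈ }))
  ...   | no _ | yes refl = inj₁ (step e w' , λ { (here x≡y) → x≢y x≡y ; (there x∈) → x∉ x∈ })
  ...   | no a≢x | no a≢y = inj₂ (inj₂ (step e w' , (λ { (here x≡a) → a≢x (sym x≡a) ; (there x∈) → x∉ x∈ }) ,
                                                     (λ { (here y≡a) → a≢y (sym y≡a) ; (there y∈) → y∉ y∈ })))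

  Side-total : ∀ {x y} → x ≢ y → ∀ t → Side x y t ⊎ Side y x t
  Side-total {x} x≢y t with Side-or-avoiding x≢y (connected x t)
  ... | inj₁ s = inj₁ s
  ... | inj₂ (inj₁ s) = inj₂ s
  ... | inj₂ (inj₂ (w , x∉ , _)) = contradiction (source∈verts w) x∉

  -- Only meaningful for adjacent x and y: otherwise both sides may hold and the value is arbitrary.
  opaque
    sideᵇ : Node → Node → Node → Bool
    sideᵇ x y t with x ≟F y
    ... | yes _ = false
    ... | no x≢y = [ const true , const false ] (Side-total x≢y t)

  opaque
    unfolding sideᵇ

    sideᵇ⇒Side : ∀ {x y t} → sideᵇ x y t ≡ true → Side x y t
    sideᵇ⇒Side {x} {y} {t} eq with x ≟F y
    ... | no x≢y with Side-total x≢y t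
    ...   | inj₁ s = s

    Side⇒sideᵇ : ∀ {x y t} → Edge graph x y → Side x y t → sideᵇ x y t ≡ true
    Side⇒sideᵇ {x} {y} {t} e s with x ≟F y
    ... | yes x≡y = contradiction x≡y (Edge-irrefl e)
    ... | no x≢y with Side-total x≢y t
    ...   | inj₁ _ = refl
    ...   | inj₂ s' = contradiction s' (Side-exclusive e s)

    ¬sideᵇ⇒Side : ∀ {x y t} → Edge graph x y → sideᵇ x y t ≡ false → Side y x t
    ¬sideᵇ⇒Side {x} {y} {t} e eq with x ≟F y
    ... | yes x≡y = contradiction x≡y (Edge-irrefl e)
    ... | no x≢y with Side-total x≢y t
    ...   | inj₂ s = s

  sideᵇ-flip : ∀ {x y t} → Edge graph x y → sideᵇ x y t ≡ false → sideᵇ y x t ≡ true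
  sideᵇ-flip e eq = Side⇒sideᵇ (Edge-sym e) (¬sideᵇ⇒Side e eq)

  sideᵇ-exclusive : ∀ {x y t} → Edge graph x y → sideᵇ x y t ≡ true → sideᵇ y x t ≡ true → ⊥
  sideᵇ-exclusive e eq₁ eq₂ = Side-exclusive e (sideᵇ⇒Side eq₁) (sideᵇ⇒Side eq₂)

  sideᵇ-true⇒flip-false : ∀ {x y t} → Edge graph x y → sideᵇ x y t ≡ true → sideᵇ y x t ≡ false
  sideᵇ-true⇒flip-false {x} {y} {t} e eq with Bool-cases (sideᵇ y x t)
  ... | inj₁ eq' = contradiction eq' (sideᵇ-exclusive e eq)
  ... | inj₂ eq' = eq'

  Side-disjoint : ∀ {a b c t} → Edge graph a b → Edge graph c b → a ≢ c → Side b a t → Side b c t → ⊥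
  Side-disjoint {a} {b} {c} e-ab e-cb a≢c (w-a , b∉a) (w-c , b∉c) =
    Side-exclusive e-ab (Side-step (Edge-sym e-cb) (Edge-irrefl e-ab) a≢c)
                        (w-a ++ʷ reverse w-c , ∉-++ʷ w-a (reverse w-c) b∉a (∉-reverse w-c b∉c))

  Side-nested : ∀ {x z t s} → Edge graph x t → Edge graph z t → x ≢ z → Side t x s → Side z t s
  Side-nested {x} {z} {t} e-xt e-zt x≢z (w , t∉) with z ∈? verts graph w
  ... | yes z∈ with prefix w z∈
  ...   | p , p⊆w = contradiction (Side-here (Edge-irrefl e-zt ∘ sym))
                                  (Side-disjoint e-xt e-zt x≢z (p , t∉ ∘ p⊆w))
  Side-nested {x} {z} {t} e-xt e-zt x≢z (w , t∉) | no z∉ =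
    step (Edge-sym e-xt) w , λ { (here z≡t) → Edge-irrefl e-zt z≡t ; (there z∈) → z∉ z∈ }

  Side-separates : ∀ {x y t₁ t₂} → Edge graph x y → Side y x t₁ → Side x y t₂ →
                   (p : Walk graph t₁ t₂) → x ∈ᴸ verts graph p
  Side-separates {x} e-xy s₁ (w₂ , x∉₂) p with x ∈? verts graph p
  ... | yes x∈ = x∈
  ... | no x∉ = contradiction s₁
                  (Side-exclusive e-xy (w₂ ++ʷ reverse p , ∉-++ʷ w₂ (reverse p) x∉₂ (∉-reverse p x∉)))

  Side-neighbour : ∀ {t s} → t ≢ s → ∃[ x ] (Edge graph t x × Side t x s)
  Side-neighbour {t} {s} t≢s = firstStep t≢s (connected t s)

  branchSize : Node → Node → ℕ
  branchSize x y = length (filter (λ t → sideᵇ x y t ≟B true) (allFin (Graph.n graph)))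

  -- Moving one edge further away from x, the branch shrinks and loses x itself.
  branchSize-< : ∀ {t x z} → Edge graph t x → Edge graph z x → z ≢ t → branchSize x z < branchSize t x
  branchSize-< {t} {x} {z} e-tx e-zx z≢t =
    length-filter-< (λ s → sideᵇ x z s ≟B true) (λ s → sideᵇ t x s ≟B true)
      (λ eq → Side⇒sideᵇ e-tx (Side-nested e-zx e-tx z≢t (sideᵇ⇒Side eq)))
      (∈-allFin x)
      (Side⇒sideᵇ e-tx (Side-here (Edge-irrefl e-tx)))
      (¬Side-source ∘ sideᵇ⇒Side {x} {z})

module _ {n : ℕ} where

  Sep-≟ : DecidableEquality (Sep n)
  Sep-≟ = ≡-dec (≡-decᵛ _≟B_) (≡-decᵛ _≟B_)

  trivial : Bool → Sep n
  trivial true = (∅ , Full)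
  trivial false = (Full , ∅)

  trivial-order : ∀ b → order (trivial b) ≤ 0
  trivial-order true = ≤-trans (∣p∩q∣≤∣p∣ (∅ {n}) Full) (≤-reflexive (∣⊥∣≡0 n))
  trivial-order false = ≤-trans (∣p∩q∣≤∣q∣ Full (∅ {n})) (≤-reflexive (∣⊥∣≡0 n))

  trivial-proper : Fin n → ∀ b → trivial b ≢ inv (trivial b)
  trivial-proper v true eq = ∉⊥ (subst (v ∈_) (sym (cong proj₁ eq)) ∈⊤)
  trivial-proper v false eq = ∉⊥ (subst (v ∈_) (cong proj₁ eq) ∈⊤)

  trivial-star : ∀ b c → trivial b ≢ trivial c → trivial b ≤ₛ inv (trivial c)
  trivial-star true true b≢c = contradiction refl b≢c
  trivial-star true false _ = id , id
  trivial-star false true _ = id , id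
  trivial-star false false b≢c = contradiction refl b≢c

  trivial-⊈⇒false : ∀ b → ¬ (proj₁ (trivial b) ⊆ proj₂ (trivial b)) → b ≡ false
  trivial-⊈⇒false true A⊈B = contradiction (λ {x} → ⊥⊆ {x = x}) A⊈B
  trivial-⊈⇒false false _ = refl

  ∅⊤≤ₛinv : ∀ (s : Sep n) → (∅ , Full) ≤ₛ inv s
  ∅⊤≤ₛinv s = ⊥⊆ , ⊆⊤

  ≤ₛinv∅⊤ : ∀ (s : Sep n) → s ≤ₛ inv (∅ , Full)
  ≤ₛinv∅⊤ s = ⊆⊤ , ⊥⊆

module _ (G : Graph) where
  open Walks G using (Edge-sym)

  trivial-IsSep : ∀ b → IsSep G (trivial b)
  trivial-IsSep true = (λ _ → inj₂ ∈⊤) , (λ _ _ u∈∅ _ _ _ _ → ∉⊥ u∈∅)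
  trivial-IsSep false = (λ _ → inj₁ ∈⊤) , (λ _ _ _ _ v∈∅ _ _ → ∉⊥ v∈∅)

  module _ {A B : Subset (Graph.n G)} (sep : IsSep G (A , B)) where

    ∉ʳ⇒∈ˡ : ∀ {x} → x ∉ B → x ∈ A
    ∉ʳ⇒∈ˡ {x} x∉B = [ id , flip contradiction x∉B ] (proj₁ sep x)

    IsSep-side : ∀ {u w} → u ≡ w ⊎ Edge G u w → (u ∈ A × w ∈ A) ⊎ (u ∈ B × w ∈ B)
    IsSep-side {u} {w} uw with u ∈ˢ? B | w ∈ˢ? B
    ... | yes u∈B | yes w∈B = inj₂ (u∈B , w∈B)
    ... | no u∉B | no w∉B = inj₁ (∉ʳ⇒∈ˡ u∉B , ∉ʳ⇒∈ˡ w∉B)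
    ... | yes u∈B | no w∉B with u ∈ˢ? A
    ...   | yes u∈A = inj₁ (u∈A , ∉ʳ⇒∈ˡ w∉B)
    ...   | no u∉A = contradiction uw
            [ (λ u≡w → w∉B (subst (_∈ B) u≡w u∈B)) , proj₂ sep w u (∉ʳ⇒∈ˡ w∉B) w∉B u∈B u∉A ∘ Edge-sym ]
    IsSep-side {u} {w} uw | no u∉B | yes w∈B with w ∈ˢ? A
    ...   | yes w∈A = inj₁ (∉ʳ⇒∈ˡ u∉B , w∈A)
    ...   | no w∉A = contradiction uw
            [ (λ u≡w → u∉B (subst (_∈ B) (sym u≡w) w∈B)) , proj₂ sep u w (∉ʳ⇒∈ˡ u∉B) u∉B w∈B w∉A ]

module Stars (G : Graph) (k : ℕ) (T : Tree) where
  open Tree T using (graph; Node; nonempty; connected)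
  open Sides T public

  root : Node
  root = fromℕ< nonempty

  Orientation : Set
  Orientation = Node → Node → Sep (Graph.n G)

  ∈-neighbours⁻ : ∀ {a t} → a ∈ᴸ filterᵇ (λ x → Graph.adj graph x t) (allFin _) → Edge graph a t
  ∈-neighbours⁻ {t = t} a∈ =
    Equivalence.to T-≡ (proj₂ (∈-filter⁻ (λ x → T? (Graph.adj graph x t)) {xs = allFin _} a∈))

  starAt-cong : ∀ {β β' : Orientation} t → (∀ a → Edge graph a t → β a t ≡ β' a t) →
                starAt G k T β t ≡ starAt G k T β' t
  starAt-cong t β≡β' = map-cong-local (All.tabulate (λ a∈ → β≡β' _ (∈-neighbours⁻ a∈)))

  module _ (β : Orientation) (t : Node) where

    ∈-starAt⁻ : ∀ {s} → s ∈ᴸ starAt G k T β t → ∃[ a ] (Edge graph a t × s ≡ β a t)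
    ∈-starAt⁻ s∈ with ∈-map⁻ (λ x → β x t) s∈
    ... | a , a∈ , refl = a , ∈-neighbours⁻ a∈ , refl

    ∈-starAt⁺ : ∀ {a} → Edge graph a t → β a t ∈ᴸ starAt G k T β t
    ∈-starAt⁺ {a} e =
      ∈-map⁺ (λ x → β x t)
        (∈-filter⁺ (λ x → T? (Graph.adj graph x t)) (∈-allFin a) (Equivalence.from T-≡ e))

    Bag : Subset (Graph.n G)
    Bag = ⋂ (map proj₂ (starAt G k T β t))

    ∈-Bag⁻ : ∀ {v a} → v ∈ Bag → Edge graph a t → v ∈ proj₂ (β a t)
    ∈-Bag⁻ v∈ e = ∈-⋂⁻ v∈ (∈-map⁺ proj₂ (∈-starAt⁺ e))

    ∈-Bag⁺ : ∀ {v} → (∀ a → Edge graph a t → v ∈ proj₂ (β a t)) → v ∈ Bag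
    ∈-Bag⁺ {v} h = ∈-⋂⁺ v∈q
      where
      v∈q : ∀ {q} → q ∈ᴸ map proj₂ (starAt G k T β t) → v ∈ q
      v∈q q∈ with ∈-map⁻ proj₂ q∈
      ... | s , s∈ , refl with ∈-starAt⁻ s∈
      ...   | a , e , refl = h a e

    starAt-InFk :
      (∀ a → Edge graph a t → IsSep G (β a t)) →
      (∀ a → Edge graph a t → β a t ≢ inv (β a t)) →
      (∀ a c → Edge graph a t → Edge graph c t → β a t ≢ β c t → β a t ≤ₛ inv (β c t)) →
      (X : Subset (Graph.n G)) → (∀ {v} → (∀ a → Edge graph a t → v ∈ proj₂ (β a t)) → v ∈ X) →
      ∣ X ∣ < k → InFk G k (starAt G k T β t)
    starAt-InFk sep proper star X Bag⊆X ∣X∣<k =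
      (λ s s∈ → on s∈ sep) ,
      ((λ s s∈ → on s∈ proper) , λ s s' s∈ s'∈ → on s∈ λ a e → on s'∈ λ c e' → star a c e e') ,
      ≤-<-trans (p⊆q⇒∣p∣≤∣q∣ (λ v∈ → Bag⊆X (λ a e → ∈-Bag⁻ v∈ e))) ∣X∣<k
      where
      on : ∀ {s} {P : Sep (Graph.n G) → Set} → s ∈ᴸ starAt G k T β t →
           (∀ a → Edge graph a t → P (β a t)) → P s
      on s∈ h with ∈-starAt⁻ s∈
      ... | a , e , refl = h a e

    module _ (F : InFk G k (starAt G k T β t)) where

      InFk-IsSep : ∀ {a} → Edge graph a t → IsSep G (β a t)
      InFk-IsSep e = proj₁ F _ (∈-starAt⁺ e)

      InFk-proper : ∀ {a} → Edge graph a t → β a t ≢ inv (β a t)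
      InFk-proper e = proj₁ (proj₁ (proj₂ F)) _ (∈-starAt⁺ e)

      InFk-star : ∀ {a c} → Edge graph a t → Edge graph c t → β a t ≢ β c t → β a t ≤ₛ inv (β c t)
      InFk-star e e' distinct = proj₂ (proj₁ (proj₂ F)) _ _ (∈-starAt⁺ e) (∈-starAt⁺ e') distinct

      InFk-∣Bag∣ : ∣ Bag ∣ < k
      InFk-∣Bag∣ = proj₂ (proj₂ F)

  -- Every separation points towards r: it is (∅ , V) when r lies on the far side of the edge.
  towards : Node → Orientation
  towards r a b = trivial (sideᵇ a b r)

  towards-inverse : ∀ r {a b} → Edge graph a b → towards r b a ≡ inv (towards r a b)
  towards-inverse r {a} {b} e with sideᵇ a b r in eq₁ | sideᵇ b a r in eq₂
  ... | true | true = contradiction eq₂ (sideᵇ-exclusive e eq₁)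
  ... | true | false = refl
  ... | false | true = refl
  ... | false | false with () ← trans (sym (sideᵇ-flip e eq₁)) eq₂

  towards-edge : 0 < k → ∀ r {a b} → Edge graph a b →
                 InSk G k (towards r a b) × towards r b a ≡ inv (towards r a b)
  towards-edge 0<k r {a} {b} e =
    (trivial-IsSep G (sideᵇ a b r) , ≤-<-trans (trivial-order (sideᵇ a b r)) 0<k) , towards-inverse r e

  -- With fewer than k vertices, the bag V at r is small enough.
  towards-IsSkTree : 0 < k → Graph.n G < k → Fin (Graph.n G) → ∀ r → IsSkTree G k T (towards r)
  towards-IsSkTree 0<k n<k v r =
    (λ a b → towards-edge 0<k r) ,
    λ t → starAt-InFk (towards r) t (λ a _ → trivial-IsSep G (sideᵇ a t r))
            (λ a _ → trivial-proper v (sideᵇ a t r))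
            (λ a c _ _ → trivial-star (sideᵇ a t r) (sideᵇ c t r))
            Full (λ _ → ∈⊤) (≤-<-trans (≤-reflexive (∣⊤∣≡n _)) n<k)

  -- From a tree-decomposition to an S_k-tree

  module FromDecomposition (D : TreeDecomposition G T) (k≤n : k ≤ Graph.n G)
                           (∣bag∣<k : ∀ t → ∣ TreeDecomposition.bag D t ∣ < k) where
    open TreeDecomposition D

    ⋃bags : Node → Node → Subset (Graph.n G)
    ⋃bags x y = ⋃ (map bag (filter (λ t → sideᵇ x y t ≟B true) (allFin _)))

    ∈-⋃bags⁻ : ∀ {x y v} → v ∈ ⋃bags x y → ∃[ s ] (sideᵇ x y s ≡ true × v ∈ bag s)
    ∈-⋃bags⁻ {x} {y} v∈ with ∈-⋃⁻ v∈
    ... | q , q∈ , v∈q with ∈-map⁻ bag q∈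
    ...   | s , s∈ , refl = s , proj₂ (∈-filter⁻ (λ t → sideᵇ x y t ≟B true) {xs = allFin _} s∈) , v∈q

    ∈-⋃bags⁺ : ∀ {x y v s} → sideᵇ x y s ≡ true → v ∈ bag s → v ∈ ⋃bags x y
    ∈-⋃bags⁺ {x} {y} {s = s} eq v∈ =
      ∈-⋃⁺ (∈-map⁺ bag (∈-filter⁺ (λ t → sideᵇ x y t ≟B true) (∈-allFin s) eq)) v∈

    induced : Orientation
    induced x y = (⋃bags y x , ⋃bags x y)

    induced-IsSep : ∀ {x y} → Edge graph x y → IsSep G (induced x y)
    induced-IsSep {x} {y} e = cover′ , no-cross
      where
      on-some-side : ∀ {v s} → v ∈ bag s → v ∈ ⋃bags y x ⊎ v ∈ ⋃bags x y
      on-some-side {s = s} v∈ with sideᵇ x y s in eq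
      ... | true = inj₂ (∈-⋃bags⁺ eq v∈)
      ... | false = inj₁ (∈-⋃bags⁺ (sideᵇ-flip e eq) v∈)
      cover′ : ∀ v → v ∈ ⋃bags y x ⊎ v ∈ ⋃bags x y
      cover′ v = on-some-side (proj₂ (cover v))
      no-cross : ∀ u w → u ∈ ⋃bags y x → u ∉ ⋃bags x y → w ∈ ⋃bags x y → w ∉ ⋃bags y x → Edge G u w → ⊥
      no-cross u w _ u∉ _ w∉ e-uw with edge-cover u w e-uw
      ... | s , u∈ , w∈ with sideᵇ x y s in eq
      ...   | true = u∉ (∈-⋃bags⁺ eq u∈)
      ...   | false = w∉ (∈-⋃bags⁺ (sideᵇ-flip e eq) w∈)

    -- Every path between the two sides passes through x, so the path condition applies.
    ∩-induced⊆bag : ∀ {x y} → Edge graph x y → ⋃bags y x ∩ ⋃bags x y ⊆ bag x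
    ∩-induced⊆bag {x} {y} e v∈ with x∈p∩q⁻ (⋃bags y x) (⋃bags x y) v∈
    ... | v∈₁ , v∈₂ with ∈-⋃bags⁻ v∈₁ | ∈-⋃bags⁻ v∈₂
    ...   | s₁ , eq₁ , v∈s₁ | s₂ , eq₂ , v∈s₂ with toPath (connected s₁ s₂)
    ...     | p , U , _ = path-cond s₁ s₂ p U x
                            (Side-separates e (sideᵇ⇒Side eq₁) (sideᵇ⇒Side eq₂) p) (x∈p∩q⁺ (v∈s₁ , v∈s₂))

    induced-order : ∀ {x y} → Edge graph x y → order (induced x y) < k
    induced-order {x} e = ≤-<-trans (p⊆q⇒∣p∣≤∣q∣ (∩-induced⊆bag e)) (∣bag∣<k x)

    -- A separation equal to its inverse is (V , V), whose order n is at least k.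
    induced-proper : ∀ {x y} → Edge graph x y → induced x y ≢ inv (induced x y)
    induced-proper {x} {y} e eq =
      <⇒≱ (induced-order e) (≤-trans k≤n (≤-trans (≤-reflexive (sym (∣⊤∣≡n _))) (p⊆q⇒∣p∣≤∣q∣ V⊆)))
      where
      V⊆ : Full ⊆ ⋃bags y x ∩ ⋃bags x y
      V⊆ {v} _ with proj₁ (induced-IsSep e) v
      ... | inj₁ v∈ = x∈p∩q⁺ (v∈ , subst (v ∈_) (cong proj₁ eq) v∈)
      ... | inj₂ v∈ = x∈p∩q⁺ (subst (v ∈_) (sym (cong proj₁ eq)) v∈ , v∈)

    induced-star : ∀ {t a c} → Edge graph a t → Edge graph c t → induced a t ≢ induced c t →
                   induced a t ≤ₛ inv (induced c t)
    induced-star {t} {a} {c} e-at e-ct distinct = shift e-at e-ct a≢c , shift e-ct e-at (a≢c ∘ sym)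
      where
      a≢c : a ≢ c
      a≢c refl = distinct refl
      shift : ∀ {a c} → Edge graph a t → Edge graph c t → a ≢ c → ⋃bags t a ⊆ ⋃bags c t
      shift e e' a≢c v∈ with ∈-⋃bags⁻ v∈
      ... | s , eq , v∈s = ∈-⋃bags⁺ (Side⇒sideᵇ e' (Side-nested e e' a≢c (sideᵇ⇒Side eq))) v∈s

    -- Compare a bag containing v with one on the far side of the neighbour of t towards it.
    ⋂induced⊆bag : ∀ t {v} → (∀ a → Edge graph a t → v ∈ ⋃bags a t) → v ∈ bag t
    ⋂induced⊆bag t {v} h with cover v
    ... | s , v∈s with s ≟F t
    ...   | yes refl = v∈s
    ...   | no s≢t with Side-neighbour (s≢t ∘ sym)
    ...     | x , e-tx , side-s with ∈-⋃bags⁻ (h x (Edge-sym e-tx))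
    ...       | s' , eq , v∈s' with toPath (connected s' s)
    ...         | p , U , _ = path-cond s' s p U t (Side-separates e-tx (sideᵇ⇒Side eq) side-s p)
                                (x∈p∩q⁺ (v∈s' , v∈s))

    induced-IsSkTree : IsSkTree G k T induced
    induced-IsSkTree =
      (λ x y e → (induced-IsSep e , induced-order e) , refl) ,
      λ t → starAt-InFk induced t (λ a → induced-IsSep) (λ a → induced-proper)
              (λ a c → induced-star) (bag t) (⋂induced⊆bag t) (∣bag∣<k t)

  -- From a consistent S_k-tree to a tree-decomposition

  Antisymmetric : Orientation → Set
  Antisymmetric β = ∀ {x y} → Edge graph x y → β y x ≡ inv (β x y)

  IsSkTree⇒Antisymmetric : ∀ {β} → IsSkTree G k T β → Antisymmetric β
  IsSkTree⇒Antisymmetric Sk {x} {y} e = proj₂ (proj₁ Sk x y e)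

  module _ {β : Orientation} (β-anti : Antisymmetric β) {x y} (e : Edge graph x y) where

    A-inverse : proj₁ (β y x) ≡ proj₂ (β x y)
    A-inverse = cong proj₁ (β-anti e)

    B-inverse : proj₂ (β y x) ≡ proj₁ (β x y)
    B-inverse = cong proj₂ (β-anti e)

  Consistent : Orientation → Set
  Consistent β = ∀ {x y z} → Edge graph x y → Edge graph z y → x ≢ z → β x y ≤ₛ inv (β z y)

  -- A property that holds on one side of every separation holds on all B-sides at some node t:
  -- walking along edges whose B-side fails it, the branch ahead shrinks, so the walk stops.
  module _ (β : Orientation) (β-anti : Antisymmetric β)
           {P : Subset (Graph.n G) → Set} (P? : Decidable P)
           (P-side : ∀ {x y} → Edge graph x y → P (proj₁ (β x y)) ⊎ P (proj₂ (β x y))) where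

    Sink : Node → Set
    Sink t = ∀ a → Edge graph a t → P (proj₂ (β a t))

    Sink-or-exit : ∀ t → Sink t ⊎ ∃[ z ] (Edge graph z t × ¬ P (proj₂ (β z t)))
    Sink-or-exit t with any? (λ a → (Graph.adj graph a t ≟B true) ×-dec ¬? (P? (proj₂ (β a t))))
    ... | yes (z , e , ¬P) = inj₂ (z , e , ¬P)
    ... | no no-exit = inj₁ sink
      where
      sink : Sink t
      sink a e with P? (proj₂ (β a t))
      ... | yes P-B = P-B
      ... | no ¬P = contradiction (a , e , ¬P) no-exit

    turn : ∀ {z x} → Edge graph z x → ¬ P (proj₂ (β z x)) → P (proj₂ (β x z))
    turn e ¬P = [ subst P (sym (B-inverse β-anti e)) , flip contradiction ¬P ] (P-side e)

    sink-beyond : ∀ m {t x} → Edge graph t x → P (proj₂ (β t x)) → branchSize t x ≤ m →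
                  ∃[ s ] Sink s
    sink-beyond m {t} {x} e-tx P-B size≤ with Sink-or-exit x
    ... | inj₁ sink = x , sink
    ... | inj₂ (z , e-zx , ¬P) with m | <-≤-trans (branchSize-< e-tx e-zx λ { refl → ¬P P-B }) size≤
    ...   | zero | ()
    ...   | suc m | size< = sink-beyond m (Edge-sym e-zx) (turn e-zx ¬P) (≤-pred size<)

    sink : ∃[ s ] Sink s
    sink with Sink-or-exit root
    ... | inj₁ sink = root , sink
    ... | inj₂ (z , e , ¬P) = sink-beyond (branchSize root z) (Edge-sym e) (turn e ¬P) ≤-refl

  module _ (β : Orientation) (β-anti : Antisymmetric β) (consistent : Consistent β)
           {v : Fin (Graph.n G)} where

    ∈Bag⇒∈A : ∀ {a c} → v ∈ Bag β a → Edge graph a c → v ∈ proj₁ (β a c)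
    ∈Bag⇒∈A v∈ e = subst (v ∈_) (B-inverse β-anti e) (∈-Bag⁻ β _ v∈ (Edge-sym e))

    ∈Bag⇒∈B : ∀ {c d b} → Edge graph c d → (p : Walk graph d b) → c ∉ᴸ verts graph p →
              IsPath graph p → v ∈ Bag β b → v ∈ proj₂ (β c d)
    ∈Bag⇒∈B e (stop _) _ _ v∈ = ∈-Bag⁻ β _ v∈ e
    ∈Bag⇒∈B e (step e' p) c∉ (d∉ ∷ U) v∈ =
      proj₂ (consistent e (Edge-sym e') λ { refl → c∉ (there (source∈verts p)) })
        (subst (v ∈_) (sym (A-inverse β-anti e')) (∈Bag⇒∈B e' p (All¬⇒¬Any d∉) U v∈))

    ∈-Bag-between : ∀ {a c d} → Edge graph a c → Edge graph c d → a ≢ d →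
                    v ∈ proj₁ (β a c) → v ∈ proj₂ (β c d) → v ∈ Bag β c × v ∈ proj₁ (β c d)
    ∈-Bag-between {a} {c} {d} e-ac e-cd a≢d v∈A v∈B =
      ∈-Bag⁺ β c v∈Bs , subst (v ∈_) (B-inverse β-anti e-cd) v∈B-dc
      where
      v∈B-dc : v ∈ proj₂ (β d c)
      v∈B-dc = proj₁ (consistent e-ac (Edge-sym e-cd) a≢d) v∈A
      v∈Bs : ∀ x → Edge graph x c → v ∈ proj₂ (β x c)
      v∈Bs x e-xc with x ≟F d
      ... | yes refl = v∈B-dc
      ... | no x≢d = proj₂ (consistent e-xc (Edge-sym e-cd) x≢d)
                           (subst (v ∈_) (sym (A-inverse β-anti e-cd)) v∈B)

    ∈-Bag-along : ∀ {a c b} → Edge graph a c → (p : Walk graph c b) → a ∉ᴸ verts graph p →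
                  IsPath graph p → v ∈ proj₁ (β a c) → v ∈ Bag β b →
                  ∀ {t} → t ∈ᴸ verts graph p → v ∈ Bag β t
    ∈-Bag-along e (stop _) _ _ _ v∈b (here refl) = v∈b
    ∈-Bag-along e (step e' p) a∉ (c∉ ∷ U) v∈A v∈b t∈
      with ∈-Bag-between e e' (λ { refl → a∉ (there (source∈verts p)) }) v∈A
                          (∈Bag⇒∈B e' p (All¬⇒¬Any c∉) U v∈b)
    ... | v∈c , v∈A' with t∈
    ...   | here refl = v∈c
    ...   | there t∈p = ∈-Bag-along e' p (All¬⇒¬Any c∉) U v∈A' v∈b t∈p

    Bag-path-closed : ∀ {a b} (p : Walk graph a b) → IsPath graph p → v ∈ Bag β a → v ∈ Bag β b →
                      ∀ {t} → t ∈ᴸ verts graph p → v ∈ Bag β t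
    Bag-path-closed (stop _) _ v∈a _ (here refl) = v∈a
    Bag-path-closed (step e p) _ v∈a _ (here refl) = v∈a
    Bag-path-closed (step e p) (a∉ ∷ U) v∈a v∈b (there t∈) =
      ∈-Bag-along e p (All¬⇒¬Any a∉) U (∈Bag⇒∈A v∈a e) v∈b t∈

  toDecomposition : ∀ β → IsSkTree G k T β → Consistent β → TreeDecomposition G T
  toDecomposition β Sk consistent = record
    { bag = Bag β
    ; cover = λ v → Data.Product.map₂ proj₁ (bag-containing v v (inj₁ refl))
    ; edge-cover = λ u w e → bag-containing u w (inj₂ e)
    ; path-cond = λ t₁ t₃ p U t₂ t₂∈ v∈ →
        Bag-path-closed β β-anti consistent p U (proj₁ (x∈p∩q⁻ (Bag β t₁) _ v∈))
                                                (proj₂ (x∈p∩q⁻ (Bag β t₁) _ v∈)) t₂∈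
    }
    where
    β-anti : Antisymmetric β
    β-anti = IsSkTree⇒Antisymmetric Sk
    bag-containing : ∀ u w → u ≡ w ⊎ Edge G u w → ∃[ t ] (u ∈ Bag β t × w ∈ Bag β t)
    bag-containing u w uw with sink β β-anti (λ X → (u ∈ˢ? X) ×-dec (w ∈ˢ? X))
                                 (λ e → IsSep-side G (proj₁ (proj₁ (proj₁ Sk _ _ e))) uw)
    ... | t , sink-t = t , ∈-Bag⁺ β t (λ a e → proj₁ (sink-t a e))
                         , ∈-Bag⁺ β t (λ a e → proj₂ (sink-t a e))

  -- Repairing clashes

  -- The star condition says nothing about equal separations at distinct neighbours; if such a
  -- separation (A , B) has A ⊈ B, consistency fails.
  Clash : Orientation → Node × Node × Node → Set
  Clash β (x , y , z) =
    Edge graph x y × Edge graph z y × x ≢ z × β x y ≡ β z y × ¬ (proj₁ (β x y) ⊆ proj₂ (β x y))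

  Clash? : ∀ β → Decidable (Clash β)
  Clash? β (x , y , z) =
    (Graph.adj graph x y ≟B true) ×-dec (Graph.adj graph z y ≟B true) ×-dec ¬? (x ≟F z) ×-dec
    Sep-≟ (β x y) (β z y) ×-dec ¬? (proj₁ (β x y) ⊆ˢ? proj₂ (β x y))

  clash? : ∀ β → Dec (∃[ x ] ∃[ y ] ∃[ z ] Clash β (x , y , z))
  clash? β = any? λ x → any? λ y → any? λ z → Clash? β (x , y , z)

  triples : List (Node × Node × Node)
  triples = cartesianProduct (allFin _) (cartesianProduct (allFin _) (allFin _))

  clashes : Orientation → ℕ
  clashes β = length (filter (Clash? β) triples)

  clashes-< : ∀ β β' → (∀ {t} → Clash β' t → Clash β t) → ∀ {t} → Clash β t → ¬ Clash β' t →
              clashes β' < clashes β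
  clashes-< β β' sub {x , y , z} =
    length-filter-< (Clash? β') (Clash? β) sub
      (∈-cartesianProduct⁺ (∈-allFin x) (∈-cartesianProduct⁺ (∈-allFin y) (∈-allFin z)))

  ¬clash⇒Consistent : ∀ β → IsSkTree G k T β → ¬ (∃[ x ] ∃[ y ] ∃[ z ] Clash β (x , y , z)) →
                      Consistent β
  ¬clash⇒Consistent β Sk ¬clash {x} {y} {z} e-xy e-zy x≢z with Sep-≟ (β x y) (β z y)
  ... | no distinct = InFk-star β y (proj₂ Sk y) e-xy e-zy distinct
  ... | yes same with proj₁ (β x y) ⊆ˢ? proj₂ (β x y)
  ...   | yes A⊆B = subst (λ s → β x y ≤ₛ inv s) same (A⊆B , A⊆B)
  ...   | no A⊈B = contradiction (x , y , z , e-xy , e-zy , x≢z , same , A⊈B) ¬clash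

  -- Reorienting the whole branch at z of a clash (x , y , z) towards y removes that clash and
  -- creates no new one.
  module Repair (α : Orientation) (Sk : IsSkTree G k T α) (v₀ : Fin (Graph.n G)) (0<k : 0 < k)
                (x y z : Node) (clash : Clash α (x , y , z)) where

    e-xy : Edge graph x y
    e-xy = proj₁ clash
    e-zy : Edge graph z y
    e-zy = proj₁ (proj₂ clash)
    x≢z : x ≢ z
    x≢z = proj₁ (proj₂ (proj₂ clash))
    same : α x y ≡ α z y
    same = proj₁ (proj₂ (proj₂ (proj₂ clash)))

    inBranch : Node → Bool
    inBranch = sideᵇ y z

    repaired : Orientation
    repaired a b = if inBranch a ∨ inBranch b then towards y a b else α a b

    repaired-towards : ∀ {a b} → inBranch a ≡ true ⊎ inBranch b ≡ true → repaired a b ≡ towards y a b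
    repaired-towards {a} {b} = if-∨-true (inBranch a) (inBranch b)

    repaired-α : ∀ {a b} → inBranch a ≡ false → inBranch b ≡ false → repaired a b ≡ α a b
    repaired-α = if-∨-false

    ¬inBranch-y : inBranch y ≡ false
    ¬inBranch-y with inBranch y in eq
    ... | false = refl
    ... | true = contradiction (sideᵇ⇒Side eq) ¬Side-source

    inBranch-z : inBranch z ≡ true
    inBranch-z = Side⇒sideᵇ (Edge-sym e-zy) (Side-here (Edge-irrefl e-zy ∘ sym))

    inBranch-neighbour-y : ∀ {a} → Edge graph a y → inBranch a ≡ true → a ≡ z
    inBranch-neighbour-y {a} e-ay eq with a ≟F z
    ... | yes a≡z = a≡z
    ... | no a≢z = contradiction (Side-step (Edge-sym e-ay) (Edge-irrefl e-zy) (a≢z ∘ sym))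
                                 (Side-exclusive (Edge-sym e-zy) (sideᵇ⇒Side eq))

    leaves-branch-at-y : ∀ {a t} → Edge graph a t → inBranch a ≡ true → inBranch t ≡ false → t ≡ y
    leaves-branch-at-y {a} {t} e-at eq₁ eq₂ with t ≟F y
    ... | yes t≡y = t≡y
    ... | no t≢y with () ← trans (sym (Side⇒sideᵇ (Edge-sym e-zy)
                                         (Side-extend (sideᵇ⇒Side eq₁) e-at (t≢y ∘ sym)))) eq₂

    repaired-edge-branch : ∀ {a b} → Edge graph a b → inBranch a ≡ true ⊎ inBranch b ≡ true →
                           InSk G k (repaired a b) × repaired b a ≡ inv (repaired a b)
    repaired-edge-branch e in-branch =
      subst₂ (λ s r → InSk G k s × r ≡ inv s)
        (sym (repaired-towards in-branch)) (sym (repaired-towards (Sum.swap in-branch))) (towards-edge 0<k y e)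

    repaired-edge : ∀ a b → Edge graph a b → InSk G k (repaired a b) × repaired b a ≡ inv (repaired a b)
    repaired-edge a b e with ∨-cases (inBranch a) (inBranch b)
    ... | inj₁ in-branch = repaired-edge-branch e in-branch
    ... | inj₂ (eq-a , eq-b) = subst₂ (λ s r → InSk G k s × r ≡ inv s)
                                  (sym (repaired-α eq-a eq-b)) (sym (repaired-α eq-b eq-a)) (proj₁ Sk a b e)

    repaired-outside : ∀ {a t} → Edge graph a t → inBranch t ≡ false → t ≢ y → repaired a t ≡ α a t
    repaired-outside {a} e eq t≢y with Bool-cases (inBranch a)
    ... | inj₁ eq-a = contradiction (leaves-branch-at-y e eq-a eq) t≢y
    ... | inj₂ eq-a = repaired-α eq-a eq

    repaired-at-y : ∀ {a} → Edge graph a y →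
                    (a ≡ z × repaired a y ≡ (∅ , Full)) ⊎ (a ≢ z × repaired a y ≡ α a y)
    repaired-at-y {a} e with a ≟F z
    ... | yes refl = inj₁ (refl , trans (repaired-towards (inj₁ inBranch-z))
                                        (cong trivial (Side⇒sideᵇ e (Side-here (Edge-irrefl e)))))
    ... | no a≢z with Bool-cases (inBranch a)
    ...   | inj₁ eq = contradiction (inBranch-neighbour-y e eq) a≢z
    ...   | inj₂ eq = inj₂ (a≢z , repaired-α eq ¬inBranch-y)

    -- Inside the branch the bag is empty: the neighbour towards y contributes (V , ∅).
    star-inside : ∀ t → inBranch t ≡ true → InFk G k (starAt G k T repaired t)
    star-inside t eq = starAt-InFk repaired t
        (λ a e → subst (IsSep G) (sym (towards-at e)) (trivial-IsSep G (sideᵇ a t y)))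
        (λ a e → subst (λ s → s ≢ inv s) (sym (towards-at e)) (trivial-proper v₀ (sideᵇ a t y)))
        (λ a c e e' → subst₂ (λ s r → s ≢ r → s ≤ₛ inv r) (sym (towards-at e)) (sym (towards-at e'))
                        (trivial-star (sideᵇ a t y) (sideᵇ c t y)))
        ∅ Bag⊆∅ (≤-<-trans (≤-reflexive (∣⊥∣≡0 (Graph.n G))) 0<k)
      where
      towards-at : ∀ {a} → Edge graph a t → repaired a t ≡ towards y a t
      towards-at _ = repaired-towards (inj₂ eq)
      t≢y : t ≢ y
      t≢y refl with () ← trans (sym eq) ¬inBranch-y
      Bag⊆∅ : ∀ {v} → (∀ a → Edge graph a t → v ∈ proj₂ (repaired a t)) → v ∈ ∅
      Bag⊆∅ {v} v∈B with Side-neighbour t≢y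
      ... | a , e , side = subst (λ b → v ∈ proj₂ (trivial b))
                                 (sideᵇ-true⇒flip-false e (Side⇒sideᵇ e side))
                                 (subst (λ s → v ∈ proj₂ s) (towards-at (Edge-sym e)) (v∈B a (Edge-sym e)))

    -- At y the bag stays within that of α: the B-side at z is now V, but α's equals that at x.
    star-y : InFk G k (starAt G k T repaired y)
    star-y = starAt-InFk repaired y sep proper star (Bag α y) Bag⊆ (InFk-∣Bag∣ α y F)
      where
      F : InFk G k (starAt G k T α y)
      F = proj₂ Sk y
      sep : ∀ a → Edge graph a y → IsSep G (repaired a y)
      sep a e with repaired-at-y e
      ... | inj₁ (_ , eq) = subst (IsSep G) (sym eq) (trivial-IsSep G true)
      ... | inj₂ (_ , eq) = subst (IsSep G) (sym eq) (InFk-IsSep α y F e)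
      proper : ∀ a → Edge graph a y → repaired a y ≢ inv (repaired a y)
      proper a e with repaired-at-y e
      ... | inj₁ (_ , eq) = subst (λ s → s ≢ inv s) (sym eq) (trivial-proper v₀ true)
      ... | inj₂ (_ , eq) = subst (λ s → s ≢ inv s) (sym eq) (InFk-proper α y F e)
      star : ∀ a c → Edge graph a y → Edge graph c y → repaired a y ≢ repaired c y →
             repaired a y ≤ₛ inv (repaired c y)
      star a c e e' with repaired-at-y e | repaired-at-y e'
      ... | inj₁ (_ , eq) | _ =
        λ _ → subst (λ s → s ≤ₛ inv (repaired c y)) (sym eq) (∅⊤≤ₛinv (repaired c y))
      ... | inj₂ _ | inj₁ (_ , eq') =
        λ _ → subst (λ s → repaired a y ≤ₛ inv s) (sym eq') (≤ₛinv∅⊤ (repaired a y))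
      ... | inj₂ (_ , eq) | inj₂ (_ , eq') =
        subst₂ (λ s r → s ≢ r → s ≤ₛ inv r) (sym eq) (sym eq') (InFk-star α y F e e')
      Bag⊆ : ∀ {v} → (∀ a → Edge graph a y → v ∈ proj₂ (repaired a y)) → v ∈ Bag α y
      Bag⊆ {v} v∈B = ∈-Bag⁺ α y v∈Bα
        where
        v∈B-x : v ∈ proj₂ (α x y)
        v∈B-x with repaired-at-y e-xy
        ... | inj₁ (x≡z , _) = contradiction x≡z x≢z
        ... | inj₂ (_ , eq) = subst (λ s → v ∈ proj₂ s) eq (v∈B x e-xy)
        v∈Bα : ∀ a → Edge graph a y → v ∈ proj₂ (α a y)
        v∈Bα a e with repaired-at-y e
        ... | inj₁ (refl , _) = subst (λ s → v ∈ proj₂ s) same v∈B-x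
        ... | inj₂ (_ , eq) = subst (λ s → v ∈ proj₂ s) eq (v∈B a e)

    repaired-IsSkTree : IsSkTree G k T repaired
    repaired-IsSkTree = repaired-edge , star
      where
      star : ∀ t → InFk G k (starAt G k T repaired t)
      star t with Bool-cases (inBranch t) | t ≟F y
      ... | inj₁ eq | _ = star-inside t eq
      ... | inj₂ _ | yes refl = star-y
      ... | inj₂ eq | no t≢y =
        subst (InFk G k) (starAt-cong {α} {repaired} t λ a e → sym (repaired-outside e eq t≢y))
          (proj₂ Sk t)

    Clash-unchanged : ∀ {a b c} → repaired a b ≡ α a b → repaired c b ≡ α c b →
                      Clash repaired (a , b , c) → Clash α (a , b , c)
    Clash-unchanged eq-a eq-c (e-ab , e-cb , a≢c , same' , A⊈B) =
      e-ab , e-cb , a≢c , trans (sym eq-a) (trans same' eq-c) ,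
      subst (λ s → ¬ (proj₁ s ⊆ proj₂ s)) eq-a A⊈B

    ¬Clash-∅⊤ : ∀ {a b c} → repaired a b ≡ (∅ , Full) ⊎ repaired c b ≡ (∅ , Full) →
                ¬ Clash repaired (a , b , c)
    ¬Clash-∅⊤ {a} {b} eq (_ , _ , _ , same' , A⊈B) =
      A⊈B (subst (λ s → proj₁ s ⊆ proj₂ s) (sym eq-a) ⊆⊤)
      where
      eq-a : repaired a b ≡ (∅ , Full)
      eq-a = [ id , trans same' ] eq

    -- Inside the branch all separations are trivial, and two distinct neighbours of b cannot both
    -- have y on their side, as the oriented-away separations (V , ∅) of a clash would require.
    Clash-repaired⇒Clash : ∀ {t} → Clash repaired t → Clash α t
    Clash-repaired⇒Clash {a , b , c} clash'@(e-ab , e-cb , a≢c , same' , A⊈B)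
      with Bool-cases (inBranch b) | b ≟F y
    ... | inj₁ eq | _ = contradiction (¬sideᵇ⇒Side e-cb (away c e-cb same'))
                                      (Side-disjoint e-ab e-cb a≢c (¬sideᵇ⇒Side e-ab (away a e-ab refl)))
      where
      towards-at : ∀ {d} → Edge graph d b → repaired d b ≡ towards y d b
      towards-at _ = repaired-towards (inj₂ eq)
      away : ∀ d → Edge graph d b → repaired a b ≡ repaired d b → sideᵇ d b y ≡ false
      away d e a≡d =
        trivial-⊈⇒false _ (subst (λ s → ¬ (proj₁ s ⊆ proj₂ s)) (trans a≡d (towards-at e)) A⊈B)
    ... | inj₂ _ | yes refl with repaired-at-y e-ab | repaired-at-y e-cb
    ...   | inj₁ (_ , eq) | _ = contradiction clash' (¬Clash-∅⊤ (inj₁ eq))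
    ...   | inj₂ _ | inj₁ (_ , eq) = contradiction clash' (¬Clash-∅⊤ (inj₂ eq))
    ...   | inj₂ (_ , eq-a) | inj₂ (_ , eq-c) = Clash-unchanged eq-a eq-c clash'
    Clash-repaired⇒Clash {a , b , c} clash'@(e-ab , e-cb , _) | inj₂ eq | no b≢y =
      Clash-unchanged (repaired-outside e-ab eq b≢y) (repaired-outside e-cb eq b≢y) clash'

    clashes-repaired : clashes repaired < clashes α
    clashes-repaired = clashes-< α repaired Clash-repaired⇒Clash clash (¬Clash-∅⊤ (inj₂ at-z))
      where
      at-z : repaired z y ≡ (∅ , Full)
      at-z with repaired-at-y e-zy
      ... | inj₁ (_ , eq) = eq
      ... | inj₂ (z≢z , _) = contradiction refl z≢z

  consistent-IsSkTree : 0 < k → Fin (Graph.n G) → ∀ β → IsSkTree G k T β →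
                        ∃[ β' ] (IsSkTree G k T β' × Consistent β')
  consistent-IsSkTree 0<k v₀ β Sk = go (clashes β) β Sk ≤-refl
    where
    go : ∀ m β → IsSkTree G k T β → clashes β ≤ m → ∃[ β' ] (IsSkTree G k T β' × Consistent β')
    go m β Sk ≤m with clash? β
    ... | no ¬clash = β , Sk , ¬clash⇒Consistent β Sk ¬clash
    ... | yes (x , y , z , clash) with m | <-≤-trans (Repair.clashes-repaired β Sk v₀ 0<k x y z clash) ≤m
    ...   | zero | ()
    ...   | suc m | < = go m (Repair.repaired β Sk v₀ 0<k x y z clash)
                               (Repair.repaired-IsSkTree β Sk v₀ 0<k x y z clash) (≤-pred <)

module _ {G : Graph} {T : Tree} (D : TreeDecomposition G T) where
  open TreeDecomposition D

  maxBag : ℕ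
  maxBag = foldr _⊔_ 0 (map (λ t → ∣ bag t ∣) (allFin (Graph.n (Tree.graph T))))

  ∣bag∣≤maxBag : ∀ t → ∣ bag t ∣ ≤ maxBag
  ∣bag∣≤maxBag t =
    foldr-preservesᵒ (λ a b → [ flip ≤-trans (m≤m⊔n a b) , flip ≤-trans (m≤n⊔m a b) ]) 0 _
      (inj₂ (Any.map ≤-reflexive (∈-map⁺ (λ t → ∣ bag t ∣) (∈-allFin t))))

  maxBag<-intro : ∀ {k} → 0 < k → (∀ t → ∣ bag t ∣ < k) → maxBag < k
  maxBag<-intro {k} 0<k ∣bag∣<k =
    foldr-preservesᵇ {P = _< k} ⊔-lub 0<k (All.map⁺ {xs = allFin _} (All.tabulate λ {t} _ → ∣bag∣<k t))

  width<⇒∣bag∣< : ∀ {k} → 0 < k → width D < k ∸ 1 → ∀ t → ∣ bag t ∣ < k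
  width<⇒∣bag∣< {k} 0<k width< t = ≤-<-trans (∣bag∣≤maxBag t) (∸1-< maxBag k 0<k width<)
    where
    ∸1-< : ∀ m k → 0 < k → m ∸ 1 < k ∸ 1 → m < k
    ∸1-< zero _ 0<k _ = 0<k
    ∸1-< (suc m) (suc k) _ m<k = s≤s m<k

  -- A vertex makes some bag, hence the maximum, positive, so that subtracting 1 is faithful.
  ∣bag∣<⇒width< : ∀ {k} → 0 < k → Fin (Graph.n G) → (∀ t → ∣ bag t ∣ < k) → width D < k ∸ 1
  ∣bag∣<⇒width< 0<k v ∣bag∣<k =
    ∸-monoˡ-< (maxBag<-intro 0<k ∣bag∣<k) (≤-trans (x∈p⇒0<∣p∣ (proj₂ (cover v))) (∣bag∣≤maxBag _))

module _ (G : Graph) (v₀ : Fin (Graph.n G)) (k : ℕ) (0<k : 0 < k) (T : Tree) where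
  open Stars G k T

  IsSkTree⇒decomposition : ∃[ α ] IsSkTree G k T α → ∃[ D ] (width {G} {T} D < k ∸ 1)
  IsSkTree⇒decomposition (α , Sk) with consistent-IsSkTree 0<k v₀ α Sk
  ... | β , Skβ , consistent =
    toDecomposition β Skβ consistent ,
    ∣bag∣<⇒width< (toDecomposition β Skβ consistent) 0<k v₀ (λ t → InFk-∣Bag∣ β t (proj₂ Skβ t))

  decomposition⇒IsSkTree : ∃[ D ] (width {G} {T} D < k ∸ 1) → ∃[ α ] IsSkTree G k T α
  decomposition⇒IsSkTree (D , width<) with Graph.n G <? k
  ... | yes n<k = towards root , towards-IsSkTree 0<k n<k v₀ root
  ... | no n≮k = induced , induced-IsSkTree
    where open FromDecomposition D (≮⇒≥ n≮k) (width<⇒∣bag∣< D 0<k width<)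

lemma6p3 : (G : Graph) → 1 ≤ Graph.n G → (k : ℕ) → 0 < k →
    ((∃[ T ] ∃[ α ] IsSkTree G k T α) ⇔ TwBelow G (k ∸ 1)) ×
    (∀ (T : Tree) → (∃[ α ] IsSkTree G k T α) ⇔ (∃[ D ] (width {G} {T} D < k ∸ 1)))
lemma6p3 G 1≤n k 0<k =
  mk⇔ (Data.Product.map₂ (to _)) (Data.Product.map₂ (from _)) , λ T → mk⇔ (to T) (from T)
  where
  v₀ : Fin (Graph.n G)
  v₀ = fromℕ< 1≤n
  to : ∀ T → ∃[ α ] IsSkTree G k T α → ∃[ D ] (width {G} {T} D < k ∸ 1)
  to = IsSkTree⇒decomposition G v₀ k 0<k
  from : ∀ T → ∃[ D ] (width {G} {T} D < k ∸ 1) → ∃[ α ] IsSkTree G k T α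
  from = decomposition⇒IsSkTree G v₀ k 0<k
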